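{- Let $a,b,p,q\in\mathbb{Z}$ and let $(W_n)_{n\ge0}$ be the Horadam sequence defined by $W_0=a$, $W_1=b$ and $W_n=pW_{n-1}+qW_{n-2}$ for $n\ge2$. Let $(V_n)_{n\ge0}$ be the generalized Lucas sequence defined by $V_0=2$, $V_1=p$ and $V_n=pV_{n-1}+qV_{n-2}$ for $n\ge 2$. Then for every positive integer $i$ and every integer $n\ge2$, \[ W_{ni+i}=V_{i}^{\,n-1}W_{2i}-(-q)^{i}\sum_{j=1}^{n-1}V_{i}^{\,n-1-j}W_{ij}. \]
   Context: $W_n=W_n(a,b;p,q)$ denotes the Horadam sequence with the given initial values and recurrence; $V_n$ is the Horadam sequence $W_n(2,p;p,q)$ (generalized Lucas numbers). -}

module Defs where

open import Data.Nat using (ℕ; zero; suc)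
open import Data.Integer using (ℤ; +_; _+_; _*_)

W : ℤ → ℤ → ℤ → ℤ → ℕ → ℤ
W a b p q zero = a
W a b p q (suc zero) = b
W a b p q (suc (suc n)) = p * W a b p q (suc n) + q * W a b p q n

V : ℤ → ℤ → ℕ → ℤ
V p q = W (+ 2) p p q

sum1to : ℕ → (ℕ → ℤ) → ℤ
sum1to zero f = + 0
sum1to (suc m) f = sum1to m f + f (suc m)

-- With U = W(0,1;p,q), the addition formula W_{m+n+1} = U_{n+1} W_{m+1} + q U_n W_m together
-- with V_i = U_{i+1} + q U_{i-1} and Cassini's identity U_i² − U_{i+1} U_{i-1} = (−q)^{i-1}
-- show that every subsequence k, k+i, k+2i, … of W satisfies the recurrence
-- X_{m+2} = V_i X_{m+1} − (−q)^i X_m. Unrolling this recurrence for X_m = W_{im} gives the formula.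
module Submission where

open import Defs
open import Data.Nat using (ℕ; _≤_; _∸_; zero; suc) renaming (_+_ to _+ℕ_; _*_ to _*ℕ_)
open import Data.Nat.Properties using (+-identityʳ; +-suc; *-suc; *-comm; n≤1+n; ≤-trans; ≤-refl; +-∸-assoc; n∸n≡0)
open import Data.Integer using (ℤ; _-_; _*_; _^_; -_; +_; _+_)
open import Data.Nat.Tactic.RingSolver using () renaming (solve-∀ to solve-ℕ)
open import Data.Integer.Tactic.RingSolver using (solve-∀)
open import Relation.Binary.PropositionalEquality using (_≡_; sym; trans; cong; cong₂; module ≡-Reasoning)
open ≡-Reasoning

U : ℤ → ℤ → ℕ → ℤ
U p q = W (+ 0) (+ 1) p q

W-addition : ∀ a b p q n m →
  W a b p q (suc n +ℕ m) ≡ U p q (suc n) * W a b p q (suc m) + q * U p q n * W a b p q m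
W-addition a b p q zero m = identity (W a b p q (suc m)) q (W a b p q m)
  where identity : ∀ x q y → x ≡ + 1 * x + q * + 0 * y
        identity = solve-∀
W-addition a b p q (suc zero) m = identity p q (W a b p q (suc m)) (W a b p q m)
  where identity : ∀ p q x y → p * x + q * y ≡ (p * + 1 + q * + 0) * x + q * + 1 * y
        identity = solve-∀
W-addition a b p q (suc (suc n)) m =
  trans (cong₂ (λ s t → p * s + q * t) (W-addition a b p q (suc n) m) (W-addition a b p q n m))
        (collect p q (U p q (suc (suc n))) (U p q (suc n)) (U p q n) (W a b p q (suc m)) (W a b p q m))
  where collect : ∀ p q u₂ u₁ u₀ x y →
                    p * (u₂ * x + q * u₁ * y) + q * (u₁ * x + q * u₀ * y)
                      ≡ (p * u₂ + q * u₁) * x + q * (p * u₁ + q * u₀) * y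
        collect = solve-∀

V-as-U : ∀ p q j → V p q (suc j) ≡ U p q (suc (suc j)) + q * U p q j
V-as-U p q j = begin
  V p q (suc j)                               ≡⟨ cong (V p q) (sym (+-identityʳ (suc j))) ⟩
  V p q (suc j +ℕ 0)                          ≡⟨ W-addition (+ 2) p p q j 0 ⟩
  U p q (suc j) * p + q * U p q j * + 2       ≡⟨ identity p q (U p q (suc j)) (U p q j) ⟩
  (p * U p q (suc j) + q * U p q j) + q * U p q j ∎
  where identity : ∀ p q u₁ u₀ → u₁ * p + q * u₀ * + 2 ≡ (p * u₁ + q * u₀) + q * u₀
        identity = solve-∀

U-cassini : ∀ p q j → U p q (suc j) * U p q (suc j) - U p q (suc (suc j)) * U p q j ≡ (- q) ^ j
U-cassini p q zero = identity p q
  where identity : ∀ p q → + 1 * + 1 - (p * + 1 + q * + 0) * + 0 ≡ + 1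
        identity = solve-∀
U-cassini p q (suc j) =
  trans (identity p q (U p q (suc j)) (U p q j)) (cong (- q *_) (U-cassini p q j))
  where identity : ∀ p q u₁ u₀ →
                     (p * u₁ + q * u₀) * (p * u₁ + q * u₀) - (p * (p * u₁ + q * u₀) + q * u₁) * u₁
                       ≡ - q * (u₁ * u₁ - (p * u₁ + q * u₀) * u₀)
        identity = solve-∀

W-stride : ∀ a b p q i k →
  W a b p q (i +ℕ i +ℕ k) ≡ V p q i * W a b p q (i +ℕ k) - (- q) ^ i * W a b p q k
W-stride a b p q zero k = identity (W a b p q k)
  where identity : ∀ y → y ≡ + 2 * y - + 1 * y
        identity = solve-∀
W-stride a b p q (suc j) k = begin
  W a b p q (suc j +ℕ suc j +ℕ k)
    ≡⟨ W-addition a b p q (j +ℕ suc j) k ⟩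
  U p q (suc j +ℕ suc j) * x + q * U p q (j +ℕ suc j) * y
    ≡⟨ cong₂ (λ s t → s * x + q * t * y)
         (W-addition (+ 0) (+ 1) p q j (suc j))
         (trans (cong (U p q) (+-suc j j)) (W-addition (+ 0) (+ 1) p q j j)) ⟩
  (u₁ * u₂ + q * u₀ * u₁) * x + q * (u₁ * u₁ + q * u₀ * u₀) * y
    ≡⟨ regroup q u₂ u₁ u₀ x y ⟩
  (u₂ + q * u₀) * (u₁ * x + q * u₀ * y) + q * (u₁ * u₁ - u₂ * u₀) * y
    ≡⟨ cong₂ (λ v w → v * w + q * (u₁ * u₁ - u₂ * u₀) * y)
         (sym (V-as-U p q j)) (sym (W-addition a b p q j k)) ⟩
  V p q (suc j) * W a b p q (suc j +ℕ k) + q * (u₁ * u₁ - u₂ * u₀) * y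
    ≡⟨ cong (λ d → V p q (suc j) * W a b p q (suc j +ℕ k) + q * d * y) (U-cassini p q j) ⟩
  V p q (suc j) * W a b p q (suc j +ℕ k) + q * (- q) ^ j * y
    ≡⟨ sign (V p q (suc j) * W a b p q (suc j +ℕ k)) q ((- q) ^ j) y ⟩
  V p q (suc j) * W a b p q (suc j +ℕ k) - (- q) ^ suc j * y ∎
  where
  x = W a b p q (suc k)
  y = W a b p q k
  u₀ = U p q j
  u₁ = U p q (suc j)
  u₂ = U p q (suc (suc j))
  regroup : ∀ q u₂ u₁ u₀ x y →
    (u₁ * u₂ + q * u₀ * u₁) * x + q * (u₁ * u₁ + q * u₀ * u₀) * y
      ≡ (u₂ + q * u₀) * (u₁ * x + q * u₀ * y) + q * (u₁ * u₁ - u₂ * u₀) * y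
  regroup = solve-∀
  sign : ∀ z q c y → z + q * c * y ≡ z - (- q * c) * y
  sign = solve-∀

*-sum1to-pow : ∀ (v : ℤ) (g : ℕ → ℤ) k m → m ≤ k →
  v * sum1to m (λ t → v ^ (k ∸ t) * g t) ≡ sum1to m (λ t → v ^ (suc k ∸ t) * g t)
*-sum1to-pow v g k zero _ = identity v
  where identity : ∀ v → v * + 0 ≡ + 0
        identity = solve-∀
*-sum1to-pow v g k (suc m) m<k =
  trans (distrib v (sum1to m (λ t → v ^ (k ∸ t) * g t)) (v ^ (k ∸ suc m)) (g (suc m)))
        (cong₂ (λ s w → s + w * g (suc m))
               (*-sum1to-pow v g k m (≤-trans (n≤1+n m) m<k))
               (cong (v ^_) (sym (+-∸-assoc 1 m<k))))
  where distrib : ∀ v s w y → v * (s + w * y) ≡ v * s + (v * w) * y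
        distrib = solve-∀

unfold-recurrence : ∀ (v c : ℤ) (X : ℕ → ℤ) →
  (∀ m → X (2 +ℕ m) ≡ v * X (suc m) - c * X m) →
  ∀ n → X (2 +ℕ n) ≡ v ^ n * X 2 - c * sum1to n (λ j → v ^ (n ∸ j) * X j)
unfold-recurrence v c X rec zero = identity (X 2) c
  where identity : ∀ x c → x ≡ + 1 * x - c * + 0
        identity = solve-∀
unfold-recurrence v c X rec (suc n) = begin
  X (3 +ℕ n)
    ≡⟨ rec (suc n) ⟩
  v * X (2 +ℕ n) - c * X (suc n)
    ≡⟨ cong (λ s → v * s - c * X (suc n)) (unfold-recurrence v c X rec n) ⟩
  v * (v ^ n * X 2 - c * S) - c * X (suc n)
    ≡⟨ expand v (v ^ n) c (X 2) S (X (suc n)) ⟩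
  v ^ suc n * X 2 - c * (v * S + + 1 * X (suc n))
    ≡⟨ cong₂ (λ s e → v ^ suc n * X 2 - c * (s + v ^ e * X (suc n)))
         (*-sum1to-pow v X n n ≤-refl) (sym (n∸n≡0 n)) ⟩
  v ^ suc n * X 2 - c * sum1to (suc n) (λ j → v ^ (suc n ∸ j) * X j) ∎
  where
  S = sum1to n (λ j → v ^ (n ∸ j) * X j)
  expand : ∀ v w c x s y → v * (w * x - c * s) - c * y ≡ (v * w) * x - c * (v * s + + 1 * y)
  expand = solve-∀

theorem2 : (a b p q : ℤ) (i n : ℕ) → 1 ≤ i → 2 ≤ n →
    W a b p q (n *ℕ i +ℕ i)
    ≡ (V p q i ^ (n ∸ 1)) * W a b p q (2 *ℕ i)
    - ((- q) ^ i) * sum1to (n ∸ 1) (λ j → (V p q i ^ (n ∸ 1 ∸ j)) * W a b p q (i *ℕ j))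
theorem2 a b p q i (suc n) _ _ = begin
  W a b p q (suc n *ℕ i +ℕ i)   ≡⟨ cong (W a b p q) (reindex n i) ⟩
  X (2 +ℕ n)                    ≡⟨ unfold-recurrence (V p q i) ((- q) ^ i) X stride n ⟩
  V p q i ^ n * X 2 - (- q) ^ i * tail
    ≡⟨ cong (λ t → V p q i ^ n * W a b p q t - (- q) ^ i * tail) (*-comm i 2) ⟩
  V p q i ^ n * W a b p q (2 *ℕ i) - (- q) ^ i * tail ∎
  where
  X : ℕ → ℤ
  X t = W a b p q (i *ℕ t)
  tail : ℤ
  tail = sum1to n (λ j → V p q i ^ (n ∸ j) * X j)
  reindex : ∀ n i → suc n *ℕ i +ℕ i ≡ i *ℕ (2 +ℕ n)
  reindex = solve-ℕ
  stride-index : ∀ i m → i *ℕ (2 +ℕ m) ≡ i +ℕ i +ℕ i *ℕ m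
  stride-index = solve-ℕ
  stride : ∀ m → X (2 +ℕ m) ≡ V p q i * X (suc m) - (- q) ^ i * X m
  stride m = begin
    X (2 +ℕ m)                   ≡⟨ cong (W a b p q) (stride-index i m) ⟩
    W a b p q (i +ℕ i +ℕ i *ℕ m) ≡⟨ W-stride a b p q i (i *ℕ m) ⟩
    V p q i * W a b p q (i +ℕ i *ℕ m) - (- q) ^ i * X m
      ≡⟨ cong (λ t → V p q i * W a b p q t - (- q) ^ i * X m) (sym (*-suc i m)) ⟩
    V p q i * X (suc m) - (- q) ^ i * X m ∎
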